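{- Let $a<b$ be positive integers and $\lambda$ a partition. Then $\lambda^{\mathrm{Cr}_{a,b}}$ is a partition if and only if for every $y\in[1,\lambda_1]$, either $\ell_{1,y}\subseteq\lambda$, or there exists a box $(i,j)\in\lambda\cap\ell_{0,y}$ such that $(i+1,j)\notin\lambda$.
   Context: Partitions are identified with Young diagrams $\{(i,j)\in\mathbb{Z}_{>0}^2: j\le\lambda_i\}$ (row $i$, column $j$). For $(x,y)\in\mathbb{Z}^2$, the ladder $\ell_{x,y}=\{(i,j)\in\mathbb{Z}_{>0}^2:\exists t\in\mathbb{Z},\ i=x-ta,\ j=y+t(b-a)\}$. $\lambda^{\mathrm{Cr}_{a,b}}$ is the set obtained by replacing, for each ladder $\ell$, the set $\lambda\cap\ell$ by the $|\lambda\cap\ell|$ points of $\ell$ with the largest first coordinates (sliding boxes down the ladder); it need not be a Young diagram of a partition. -}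

module Defs where

open import Data.Nat
open import Data.Nat.Properties using (_≤?_; m<n⇒0<n∸m)
open import Data.Integer as ℤ using (ℤ; +_)
open import Data.List using (List; []; _∷_; map; upTo; take; length; filter)
open import Data.List.Relation.Unary.Linked using (Linked)
open import Data.List.Membership.Propositional using (_∈_)
open import Data.Product using (_×_; _,_; ∃-syntax; proj₁; proj₂)
open import Relation.Nullary.Decidable using (Dec; _×-dec_)
open import Relation.Binary.PropositionalEquality using (_≡_)
open import Function.Bundles using (_⇔_)

-- A partition is a weakly decreasing list of parts (trailing zeros allowed,
-- they do not change the Young diagram).
IsPartition : List ℕ → Set
IsPartition lam = Linked _≥_ lam

-- part lam i = λ_i (1-indexed; 0 outside the list and for i = 0)
part : List ℕ → ℕ → ℕ
part []       _             = 0
part (x ∷ xs) zero          = 0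
part (x ∷ xs) (suc zero)    = x
part (x ∷ xs) (suc (suc i)) = part xs (suc i)

InDiagram : List ℕ → ℕ → ℕ → Set
InDiagram lam i j = 1 ≤ i × 1 ≤ j × j ≤ part lam i

inDiagram? : (lam : List ℕ) → (p : ℕ × ℕ) → Dec (InDiagram lam (proj₁ p) (proj₂ p))
inDiagram? lam (i , j) = (1 ≤? i) ×-dec ((1 ≤? j) ×-dec (j ≤? part lam i))

InLadder : (a b : ℕ) → (x y : ℤ) → ℕ → ℕ → Set
InLadder a b x y i j =
  1 ≤ i × 1 ≤ j × ∃[ t ] ((+ i ≡ x ℤ.- t ℤ.* + a) × (+ j ≡ y ℤ.+ t ℤ.* (+ b ℤ.- + a)))

-- All points of the ladder through the box (i,j) (i,j ≥ 1), listed in order of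
-- strictly decreasing first coordinate.  Here d = b - a.
-- Bottom point: (I , J) = (i + s a , j - s d), s = ⌊(j-1)/d⌋;
-- then (I - t a , J + t d) for t = 0 .. ⌊(I-1)/a⌋.
ladderList : (a d : ℕ) → .{{NonZero a}} → .{{NonZero d}} → ℕ → ℕ → List (ℕ × ℕ)
ladderList a d i j = map (λ t → (I ∸ t * a , J + t * d)) (upTo (suc ((I ∸ 1) / a)))
  where
  s = (j ∸ 1) / d
  I = i + s * a
  J = j ∸ s * d

-- λ^{Cr_{a,b}} as a set of boxes: a box (i,j) lies in it iff it is one of the
-- |λ ∩ ℓ| points of its ladder ℓ with the largest first coordinates.
InCr : (a b : ℕ) → 0 < a → a < b → List ℕ → ℕ → ℕ → Set
InCr a b 0<a a<b lam i j = 1 ≤ i × 1 ≤ j × (i , j) ∈ take k L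
  where
  L = ladderList a (b ∸ a) {{>-nonZero 0<a}} {{>-nonZero (m<n⇒0<n∸m a<b)}} i j
  k = length (filter (inDiagram? lam) L)

IsPartitionSet : (ℕ → ℕ → Set) → Set
IsPartitionSet S = ∃[ mu ] (IsPartition mu × (∀ i j → S i j ⇔ InDiagram mu i j))

module Submission where

-- Write d = b − a.  Every ladder has a lowest box (I , J) with 1 ≤ J ≤ d, and its boxes are
-- (I − t a , J + t d) for t a < I; λ^Cr keeps the first c of them, where c counts the boxes
-- of λ on the ladder.  λ^Cr is finite and always closed to the left, so it is a partition iff
-- it is closed upward.  Raising a ladder by one row matches its boxes with those of the raised
-- ladder, and as λ is closed upward the count can only drop when the ladder reaches row 1, at
-- (1 , y): the raised ladder is then ℓ_{0,y}, one box shorter than ℓ_{1,y}.  The condition at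
-- y says exactly that this loss is compensated: either all of ℓ_{1,y} lies in λ, or some box
-- of λ on ℓ_{0,y} has its lower neighbour outside λ.  Conversely, if it fails at y, the last
-- box of λ^Cr on ℓ_{1,y} lies below a box of ℓ_{0,y} that is not in λ^Cr.

open import Defs
open import Data.Nat
open import Data.Nat.Properties
open import Data.Nat.DivMod
open import Data.Integer as ℤ using (ℤ; +_; -[1+_])
open import Data.Integer.Properties using (pos-+; pos-*; +-injective; m-n≡m⊖n; ⊖-≥)
open import Data.Integer.Tactic.RingSolver using (solve-∀)
open import Data.List using (List; _∷_; map; upTo; take; length; filter; applyUpTo)
open import Data.List.Properties using (map-upTo; length-applyUpTo)
open import Data.List.Relation.Unary.Linked using ([]; [-]; _∷_)
open import Data.List.Relation.Unary.Linked.Properties using (applyUpTo⁺₂)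
open import Data.List.Membership.Propositional using (_∈_)
open import Data.List.Membership.Propositional.Properties using (∈-applyUpTo⁺; ∈-applyUpTo⁻)
open import Data.Product using (_×_; _,_; ∃-syntax; proj₁; proj₂; uncurry)
open import Data.Product.Properties using (≡-dec)
open import Data.List.Membership.DecPropositional (≡-dec _≟_ _≟_) using (_∈?_)
open import Data.Sum using (_⊎_; inj₁; inj₂)
open import Function using (_∘_; id)
open import Function.Bundles using (_⇔_; mk⇔; Equivalence)
open import Function.Construct.Composition using (_⇔-∘_)
open import Level using (0ℓ)
open import Relation.Nullary using (¬_; Dec; yes; no; contradiction)
open import Relation.Nullary.Decidable using (_×-dec_)
open import Relation.Unary using (Pred; Decidable)
open import Relation.Binary.PropositionalEquality
  using (_≡_; refl; sym; trans; cong; cong₂; subst; subst₂; module ≡-Reasoning)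

[r+q*n]/n≡q : ∀ n .{{_ : NonZero n}} q r → r < n → (r + q * n) / n ≡ q
[r+q*n]/n≡q n q r r<n = ≤-antisym
  (s≤s⁻¹ (m<n*o⇒m/o<n {o = n} (+-monoˡ-< (q * n) r<n)))
  (subst (_≤ (r + q * n) / n) (m*n/n≡m q n) (/-monoˡ-≤ n (m≤n+m (q * n) r)))

take-applyUpTo : ∀ {A : Set} (f : ℕ → A) k n → take k (applyUpTo f n) ≡ applyUpTo f (k ⊓ n)
take-applyUpTo f zero    n       = refl
take-applyUpTo f (suc k) zero    = refl
take-applyUpTo f (suc k) (suc n) = cong (f 0 ∷_) (take-applyUpTo (f ∘ suc) k n)

-- Counting the terms of a sequence that satisfy a predicate

module _ {A : Set} {P : Pred A 0ℓ} (P? : Decidable P) where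

  countUpTo : (ℕ → A) → ℕ → ℕ
  countUpTo f n = length (filter P? (applyUpTo f n))

  countUpTo-≤ : ∀ f n → countUpTo f n ≤ n
  countUpTo-≤ f zero = z≤n
  countUpTo-≤ f (suc n) with P? (f 0)
  ... | yes _ = s≤s (countUpTo-≤ (f ∘ suc) n)
  ... | no  _ = m≤n⇒m≤1+n (countUpTo-≤ (f ∘ suc) n)

  countUpTo-mono : ∀ f g n → (∀ {u} → u < n → P (f u) → P (g u)) →
                   countUpTo f n ≤ countUpTo g n
  countUpTo-mono f g zero    f⇒g = z≤n
  countUpTo-mono f g (suc n) f⇒g with P? (f 0) | P? (g 0)
  ... | yes _  | yes _  = s≤s (countUpTo-mono (f ∘ suc) (g ∘ suc) n (f⇒g ∘ s≤s))
  ... | yes pf | no ¬pg = contradiction (f⇒g z<s pf) ¬pg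
  ... | no _   | yes _  = m≤n⇒m≤1+n (countUpTo-mono (f ∘ suc) (g ∘ suc) n (f⇒g ∘ s≤s))
  ... | no _   | no _   = countUpTo-mono (f ∘ suc) (g ∘ suc) n (f⇒g ∘ s≤s)

  countUpTo-mono-< : ∀ f g n → (∀ {u} → u < n → P (f u) → P (g u)) →
                     ∀ {u₀} → u₀ < n → P (g u₀) → ¬ P (f u₀) →
                     countUpTo f n < countUpTo g n
  countUpTo-mono-< f g (suc n) f⇒g {zero} _ pg ¬pf with P? (f 0) | P? (g 0)
  ... | yes pf | _      = contradiction pf ¬pf
  ... | no _   | yes _  = s≤s (countUpTo-mono (f ∘ suc) (g ∘ suc) n (f⇒g ∘ s≤s))
  ... | no _   | no ¬pg = contradiction pg ¬pg
  countUpTo-mono-< f g (suc n) f⇒g {suc u₀} (s≤s u₀<n) pg ¬pf with P? (f 0) | P? (g 0)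
  ... | yes _  | yes _  = s≤s (countUpTo-mono-< (f ∘ suc) (g ∘ suc) n (f⇒g ∘ s≤s) u₀<n pg ¬pf)
  ... | yes pf | no ¬pg = contradiction (f⇒g z<s pf) ¬pg
  ... | no _   | yes _  = m<n⇒m<1+n (countUpTo-mono-< (f ∘ suc) (g ∘ suc) n (f⇒g ∘ s≤s) u₀<n pg ¬pf)
  ... | no _   | no _   = countUpTo-mono-< (f ∘ suc) (g ∘ suc) n (f⇒g ∘ s≤s) u₀<n pg ¬pf

  countUpTo-accept : ∀ f n → P (f n) → countUpTo f (suc n) ≡ suc (countUpTo f n)
  countUpTo-accept f zero    pfn with P? (f 0)
  ... | yes _   = refl
  ... | no ¬pfn = contradiction pfn ¬pfn
  countUpTo-accept f (suc n) pfn with P? (f 0)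
  ... | yes _ = cong suc (countUpTo-accept (f ∘ suc) n pfn)
  ... | no  _ = countUpTo-accept (f ∘ suc) n pfn

  countUpTo-reject : ∀ f n → ¬ P (f n) → countUpTo f (suc n) ≡ countUpTo f n
  countUpTo-reject f zero    ¬pfn with P? (f 0)
  ... | yes pfn = contradiction pfn ¬pfn
  ... | no _    = refl
  countUpTo-reject f (suc n) ¬pfn with P? (f 0)
  ... | yes _ = cong suc (countUpTo-reject (f ∘ suc) n ¬pfn)
  ... | no  _ = countUpTo-reject (f ∘ suc) n ¬pfn

  countUpTo-monoʳ : ∀ f {m n} → m ≤ n → countUpTo f m ≤ countUpTo f n
  countUpTo-monoʳ f {n = n} z≤n = z≤n
  countUpTo-monoʳ f (s≤s {m} {n} m≤n) with P? (f 0)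
  ... | yes _ = s≤s (countUpTo-monoʳ (f ∘ suc) m≤n)
  ... | no  _ = countUpTo-monoʳ (f ∘ suc) m≤n

  countUpTo-all⁺ : ∀ f n → (∀ {u} → u < n → P (f u)) → n ≤ countUpTo f n
  countUpTo-all⁺ f zero    all = z≤n
  countUpTo-all⁺ f (suc n) all with P? (f 0)
  ... | yes _  = s≤s (countUpTo-all⁺ (f ∘ suc) n (all ∘ s≤s))
  ... | no ¬pf = contradiction (all z<s) ¬pf

  countUpTo-all⁻ : ∀ f n → n ≤ countUpTo f n → ∀ {u} → u < n → P (f u)
  countUpTo-all⁻ f (suc n) full {u} u<n with P? (f 0)
  countUpTo-all⁻ f (suc n) full {zero}  _          | yes pf = pf
  countUpTo-all⁻ f (suc n) full {suc u} (s≤s u<n) | yes _  = countUpTo-all⁻ (f ∘ suc) n (s≤s⁻¹ full) u<n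
  ... | no _ = contradiction full (<⇒≱ (s≤s (countUpTo-≤ (f ∘ suc) n)))

  private
    Disagree : (ℕ → A) → (ℕ → A) → ℕ → Set
    Disagree f g n = ∃[ u ] (u < n × P (g u) × ¬ P (f u))

    disagree-suc : ∀ f g n → Disagree (f ∘ suc) (g ∘ suc) n → Disagree f g (suc n)
    disagree-suc f g n (u , u<n , pg , ¬pf) = suc u , s≤s u<n , pg , ¬pf

  countUpTo-<⇒∃ : ∀ f g n → countUpTo f n < countUpTo g n →
                  ∃[ u ] (u < n × P (g u) × ¬ P (f u))
  countUpTo-<⇒∃ f g (suc n) lt with P? (f 0) | P? (g 0)
  ... | no ¬pf | yes pg = 0 , z<s , pg , ¬pf
  ... | yes _  | yes _  = disagree-suc f g n (countUpTo-<⇒∃ (f ∘ suc) (g ∘ suc) n (s<s⁻¹ lt))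
  ... | yes _  | no _   = disagree-suc f g n (countUpTo-<⇒∃ (f ∘ suc) (g ∘ suc) n (<⇒≤ lt))
  ... | no _   | no _   = disagree-suc f g n (countUpTo-<⇒∃ (f ∘ suc) (g ∘ suc) n lt)

  countUpTo-pos⇒∃ : ∀ f n → 0 < countUpTo f n → ∃[ u ] (u < n × P (f u))
  countUpTo-pos⇒∃ f (suc n) pos with P? (f 0)
  ... | yes pf = 0 , z<s , pf
  ... | no _   with countUpTo-pos⇒∃ (f ∘ suc) n pos
  ...   | u , u<n , pf = suc u , s≤s u<n , pf

  countUpTo-bounded : ∀ f n B → (∀ {u} → u < n → P (f u) → u < B) → countUpTo f n ≤ B
  countUpTo-bounded f zero    B       below = z≤n
  countUpTo-bounded f (suc n) B       below with P? (f 0)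
  countUpTo-bounded f (suc n) zero    below | yes pf = contradiction (below z<s pf) λ ()
  countUpTo-bounded f (suc n) (suc B) below | yes _  =
    s≤s (countUpTo-bounded (f ∘ suc) n B λ u<n pf → s<s⁻¹ (below (s≤s u<n) pf))
  ... | no _ = countUpTo-bounded (f ∘ suc) n B λ u<n pf → <⇒≤ (below (s≤s u<n) pf)

  countUpTo-suc : ∀ f n → countUpTo f (suc n) ≤ suc (countUpTo (f ∘ suc) n)
  countUpTo-suc f n with P? (f 0)
  ... | yes _ = ≤-refl
  ... | no  _ = n≤1+n _

-- Young diagrams

UpClosed : (ℕ → ℕ → Set) → Set
UpClosed S = ∀ i j → 1 ≤ i → S (suc i) j → S i j

LeftClosed : (ℕ → ℕ → Set) → Set
LeftClosed S = ∀ i j → 1 ≤ j → S i (suc j) → S i j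

part-applyUpTo : ∀ f n k → k < n → part (applyUpTo f n) (suc k) ≡ f k
part-applyUpTo f (suc n) zero    _         = refl
part-applyUpTo f (suc n) (suc k) (s≤s k<n) = part-applyUpTo (f ∘ suc) n k k<n

part-length : ∀ xs i → 0 < part xs i → i ≤ length xs
part-length (x ∷ xs) (suc zero)    _   = s≤s z≤n
part-length (x ∷ xs) (suc (suc i)) pos = s≤s (part-length xs (suc i) pos)

part-anti : ∀ {xs} → IsPartition xs → ∀ i → part xs (suc (suc i)) ≤ part xs (suc i)
part-anti []             i       = z≤n
part-anti [-]            i       = z≤n
part-anti (x≥y ∷ _)      zero    = x≥y
part-anti (_ ∷ y∷ys↑)    (suc i) = part-anti y∷ys↑ i

part≤part₁ : ∀ {xs} → IsPartition xs → ∀ {i} → 1 ≤ i → part xs i ≤ part xs 1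
part≤part₁ xs↓ {suc zero}    _ = ≤-refl
part≤part₁ xs↓ {suc (suc i)} _ = ≤-trans (part-anti xs↓ i) (part≤part₁ xs↓ {suc i} (s≤s z≤n))

InDiagram-upClosed : ∀ {lam} → IsPartition lam → UpClosed (InDiagram lam)
InDiagram-upClosed lam↓ (suc i) j _ (_ , 1≤j , j≤λ) = s≤s z≤n , 1≤j , ≤-trans j≤λ (part-anti lam↓ i)

InDiagram-leftClosed : ∀ {lam} → LeftClosed (InDiagram lam)
InDiagram-leftClosed i j 1≤j (1≤i , _ , 1+j≤λ) = 1≤i , 1≤j , <⇒≤ 1+j≤λ

IsPartitionSet⇒upClosed : ∀ {S} → IsPartitionSet S → UpClosed S
IsPartitionSet⇒upClosed (mu , mu↓ , S⇔mu) i j 1≤i s =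
  Equivalence.from (S⇔mu i j) (InDiagram-upClosed mu↓ i j 1≤i (Equivalence.to (S⇔mu (suc i) j) s))

module _ {S : ℕ → ℕ → Set} (S? : ∀ i j → Dec (S i j))
         (positive : ∀ {i j} → S i j → 1 ≤ i × 1 ≤ j)
         (up : UpClosed S) (left : LeftClosed S)
         (R C : ℕ) (bounded : ∀ {i j} → S i j → i ≤ R × j ≤ C) where

  private
    leftClosed* : ∀ {i j} k → 1 ≤ j → j ≤ k → S i k → S i j
    leftClosed* k 1≤j j≤k s with m≤n⇒m<n∨m≡n j≤k
    ... | inj₂ refl = s
    leftClosed* (suc k) 1≤j _ s | inj₁ (s≤s j≤k) = leftClosed* k 1≤j j≤k (left _ k (≤-trans 1≤j j≤k) s)

    box? : Decidable (uncurry S)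
    box? (i , j) = S? i j

    rowBox : ℕ → ℕ → ℕ × ℕ
    rowBox i u = i , suc u

    -- Since S is closed to the left, its row i is {1 , … , rowLength i}.
    rowLength : ℕ → ℕ
    rowLength i = countUpTo box? (rowBox i) C

    ≤rowLength : ∀ {i j} → S i j → j ≤ rowLength i
    ≤rowLength {i} {j} s = ≤-trans
      (countUpTo-all⁺ box? (rowBox i) j λ u<j → leftClosed* j (s≤s z≤n) u<j s)
      (countUpTo-monoʳ box? (rowBox i) (proj₂ (bounded s)))

    ≤rowLength⇒ : ∀ i j → 1 ≤ j → j ≤ rowLength i → S i j
    ≤rowLength⇒ i (suc j) _ j<row with S? i (suc j)
    ... | yes s  = s
    ... | no ¬s = contradiction j<row (<⇒≱ (s≤s (countUpTo-bounded box? (rowBox i) C j below)))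
      where
      below : ∀ {u} → u < C → S i (suc u) → u < j
      below {u} _ s = ≰⇒> λ j≤u → ¬s (leftClosed* (suc u) (s≤s z≤n) (s≤s j≤u) s)

    rowLength-anti : ∀ k → rowLength (suc (suc k)) ≤ rowLength (suc k)
    rowLength-anti k = countUpTo-mono box? (rowBox (suc (suc k))) (rowBox (suc k)) C λ _ → up (suc k) _ (s≤s z≤n)

  closed⇒IsPartitionSet : IsPartitionSet S
  closed⇒IsPartitionSet = mu , applyUpTo⁺₂ (rowLength ∘ suc) R rowLength-anti , λ i j → mk⇔ (to i j) (from i j)
    where
    mu : List ℕ
    mu = applyUpTo (rowLength ∘ suc) R

    to : ∀ i j → S i j → InDiagram mu i j
    to zero    j s = contradiction (proj₁ (positive s)) λ ()
    to (suc k) j s = s≤s z≤n , proj₂ (positive s) ,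
      subst (j ≤_) (sym (part-applyUpTo (rowLength ∘ suc) R k (proj₁ (bounded s)))) (≤rowLength s)

    from : ∀ i j → InDiagram mu i j → S i j
    from (suc k) j (_ , 1≤j , j≤part) = ≤rowLength⇒ (suc k) j 1≤j
      (subst (j ≤_) (part-applyUpTo (rowLength ∘ suc) R k k<R) j≤part)
      where
      k<R : k < R
      k<R = subst (suc k ≤_) (length-applyUpTo (rowLength ∘ suc) R)
              (part-length mu (suc k) (≤-trans 1≤j j≤part))

-- Sliding boxes down the ladders

module SlideDown (a b : ℕ) (0<a : 0 < a) (a<b : a < b) (lam : List ℕ) (lam↓ : IsPartition lam) where

  d : ℕ
  d = b ∸ a

  1≤d : 1 ≤ d
  1≤d = m<n⇒0<n∸m a<b

  instance
    a-nonZero : NonZero a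
    a-nonZero = >-nonZero 0<a
    d-nonZero : NonZero d
    d-nonZero = >-nonZero 1≤d

  Cr : ℕ → ℕ → Set
  Cr = InCr a b 0<a a<b lam

  InLam : ℕ × ℕ → Set
  InLam p = InDiagram lam (proj₁ p) (proj₂ p)

  inLam? : ∀ p → Dec (InLam p)
  inLam? = inDiagram? lam

  BaseColumn : ℕ → Set
  BaseColumn J = 1 ≤ J × J ≤ d

  -- rung I J t is the t-th box, counted from the bottom, of the ladder with lowest box (I , J).
  rung : ℕ → ℕ → ℕ → ℕ × ℕ
  rung I J t = I ∸ t * a , J + t * d

  height : ℕ → ℕ
  height I = suc ((I ∸ 1) / a)

  ladderCount : ℕ → ℕ → ℕ
  ladderCount I J = countUpTo inLam? (rung I J) (height I)

  column-decomposition : ∀ {j} → 1 ≤ j → ∃[ J ] ∃[ t ] (BaseColumn J × J + t * d ≡ j)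
  column-decomposition {suc j} _ =
    suc (j % d) , j / d , (s≤s z≤n , m%n<n j d) , cong suc (sym (m≡m%n+[m/n]*n j d))

  base-index : ∀ {J} t → BaseColumn J → (J + t * d ∸ 1) / d ≡ t
  base-index {suc J} t (_ , J<d) = [r+q*n]/n≡q d t J J<d

  ladderList-base : ∀ {J} i t → BaseColumn J →
                    ladderList a d i (J + t * d) ≡ applyUpTo (rung (i + t * a) J) (height (i + t * a))
  ladderList-base {J} i t J₀ = begin
      ladderList a d i (J + t * d)
    ≡⟨ cong (λ s → map (rung (i + s * a) (J + t * d ∸ s * d)) (upTo (height (i + s * a))))
            (base-index t J₀) ⟩
      map (rung (i + t * a) (J + t * d ∸ t * d)) (upTo (height (i + t * a)))
    ≡⟨ cong (λ J′ → map (rung (i + t * a) J′) (upTo (height (i + t * a)))) (m+n∸n≡m J (t * d)) ⟩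
      map (rung (i + t * a) J) (upTo (height (i + t * a)))
    ≡⟨ map-upTo (rung (i + t * a) J) (height (i + t * a)) ⟩
      applyUpTo (rung (i + t * a) J) (height (i + t * a))
    ∎
    where open ≡-Reasoning

  rung-base : ∀ i J t → rung (i + t * a) J t ≡ (i , J + t * d)
  rung-base i J t = cong (_, J + t * d) (m+n∸n≡m i (t * a))

  rung-injective : ∀ {I J u v} → rung I J u ≡ rung I J v → u ≡ v
  rung-injective {J = J} {u} {v} eq = *-cancelʳ-≡ u v d (+-cancelˡ-≡ J (u * d) (v * d) (cong proj₂ eq))

  *a<⇒<height : ∀ {t I} → t * a < I → t < height I
  *a<⇒<height {t} {suc I} (s≤s ta≤I) = s≤s (subst (_≤ I / a) (m*n/n≡m t a) (/-monoˡ-≤ a ta≤I))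

  private
    Member : ℕ → ℕ → List (ℕ × ℕ) → Set
    Member i j L = (i , j) ∈ take (length (filter (inDiagram? lam) L)) L

  Cr⇔ : ∀ {i J} t → 1 ≤ i → BaseColumn J → Cr i (J + t * d) ⇔ t < ladderCount (i + t * a) J
  Cr⇔ {i} {J} t 1≤i J₀ = mk⇔ to from
    where
    h : ℕ → ℕ × ℕ
    h = rung (i + t * a) J
    n : ℕ
    n = height (i + t * a)
    c : ℕ
    c = ladderCount (i + t * a) J

    member≡ : Member i (J + t * d) (ladderList a d i (J + t * d)) ≡ ((i , J + t * d) ∈ applyUpTo h (c ⊓ n))
    member≡ = trans (cong (Member i (J + t * d)) (ladderList-base i t J₀))
                    (cong ((i , J + t * d) ∈_) (take-applyUpTo h c n))

    to : Cr i (J + t * d) → t < c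
    to (_ , _ , m) with ∈-applyUpTo⁻ h (subst id member≡ m)
    ... | u , u<c⊓n , eq =
      subst (_< c) (rung-injective (trans (sym eq) (sym (rung-base i J t)))) (m<n⊓o⇒m<n c n u<c⊓n)

    from : t < c → Cr i (J + t * d)
    from t<c = 1≤i , ≤-trans (proj₁ J₀) (m≤m+n J (t * d)) ,
      subst id (sym member≡)
        (subst (_∈ applyUpTo h (c ⊓ n)) (rung-base i J t)
          (∈-applyUpTo⁺ h (⊓-pres-m< t<c (*a<⇒<height (+-monoˡ-≤ (t * a) 1≤i)))))

  height-suc-*a : ∀ s → height (suc (s * a)) ≡ suc s
  height-suc-*a s = cong suc (m*n/n≡m s a)

  height-*a : ∀ {s} → 1 ≤ s → height (s * a) ≡ s
  height-*a {suc s} _ = cong suc (begin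
      (a + s * a ∸ 1) / a    ≡⟨ cong (_/ a) (+-∸-comm (s * a) 0<a) ⟩
      (a ∸ 1 + s * a) / a    ≡⟨ [r+q*n]/n≡q a s (a ∸ 1) (∸-monoʳ-< {o = 0} z<s 0<a) ⟩
      s                      ∎)
    where open ≡-Reasoning

  height-+a : ∀ {I} → 1 ≤ I → height (I + a) ≡ suc (height I)
  height-+a {suc I} _ = cong suc (begin
      (I + a) / a            ≡⟨ m/n≡1+[m∸n]/n (m≤n+m a I) ⟩
      suc ((I + a ∸ a) / a)  ≡⟨ cong (λ m → suc (m / a)) (m+n∸n≡m I a) ⟩
      suc (I / a)            ∎)
    where open ≡-Reasoning

  rung-suc : ∀ {I} J u → u * a ≤ I → proj₁ (rung (suc I) J u) ≡ suc (proj₁ (rung I J u))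
  rung-suc J u ua≤I = +-∸-assoc 1 ua≤I

  rung-lift : ∀ {I J u} → u * a < I → InLam (rung (suc I) J u) → InLam (rung I J u)
  rung-lift {I} {J} {u} ua<I in⁺ = InDiagram-upClosed lam↓ (I ∸ u * a) (J + u * d) (m<n⇒0<n∸m ua<I)
    (subst (λ r → InDiagram lam r (J + u * d)) (rung-suc J u (<⇒≤ ua<I)) in⁺)

  -- For y = J + s d, the ladders ℓ_{1,y} and ℓ_{0,y} are rung (suc (s * a)) J and rung (s * a) J.
  RungCondition : ℕ → ℕ → Set
  RungCondition J s =
    (∀ {u} → u ≤ s → InLam (rung (suc (s * a)) J u))
    ⊎ ∃[ u ] (u < s × InLam (rung (s * a) J u) × ¬ InLam (rung (suc (s * a)) J u))

  RungConditions : Set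
  RungConditions = ∀ {J s} → BaseColumn J → InLam (rung (suc (s * a)) J s) → RungCondition J s

  ladderCount-up-top : ∀ {J s t} → (InLam (rung (suc (s * a)) J s) → RungCondition J s) →
                       t < s → t < ladderCount (suc (s * a)) J → t < ladderCount (s * a) J
  ladderCount-up-top {J} {s} {t} condition t<s t<c⁺ =
    subst (t <_) (sym (cong (count h) (height-*a (≤-<-trans z≤n t<s))))
      (below (subst (t <_) (cong (count h⁺) (height-suc-*a s)) t<c⁺))
    where
    open ≤-Reasoning
    count : (ℕ → ℕ × ℕ) → ℕ → ℕ
    count = countUpTo inLam?
    h⁺ : ℕ → ℕ × ℕ
    h⁺ = rung (suc (s * a)) J
    h : ℕ → ℕ × ℕ
    h = rung (s * a) J

    lifted : ∀ {u} → u < s → InLam (h⁺ u) → InLam (h u)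
    lifted {u} u<s = rung-lift {J = J} {u} (*-monoˡ-< a u<s)

    below : t < count h⁺ (suc s) → t < count h s
    below t<c⁺ with inLam? (h⁺ s)
    ... | no out = begin-strict
      t                  <⟨ t<c⁺ ⟩
      count h⁺ (suc s)   ≡⟨ countUpTo-reject inLam? h⁺ s out ⟩
      count h⁺ s         ≤⟨ countUpTo-mono inLam? h⁺ h s lifted ⟩
      count h s          ∎
    ... | yes top with condition top
    ...   | inj₁ all = begin-strict
      t                  <⟨ t<s ⟩
      s                  ≤⟨ countUpTo-all⁺ inLam? h s (λ u<s → lifted u<s (all (<⇒≤ u<s))) ⟩
      count h s          ∎
    ...   | inj₂ (u₀ , u₀<s , in₀ , out₀) = begin-strict
      t                  <⟨ t<c⁺ ⟩
      count h⁺ (suc s)   ≡⟨ countUpTo-accept inLam? h⁺ s top ⟩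
      suc (count h⁺ s)   ≤⟨ countUpTo-mono-< inLam? h⁺ h s lifted u₀<s in₀ out₀ ⟩
      count h s          ∎

  ladderCount-up : RungConditions → ∀ {I J t} → BaseColumn J → t * a < I →
                   t < ladderCount (suc I) J → t < ladderCount I J
  ladderCount-up conditions {I} {J} {t} J₀ ta<I with m≤n⇒m<n∨m≡n (m/n*n≤m I a)
  ... | inj₁ qa<I = λ t<c⁺ → begin-strict
      t                            <⟨ t<c⁺ ⟩
      countUpTo inLam? h⁺ (suc q)  ≤⟨ countUpTo-mono inLam? h⁺ h (suc q) lifted ⟩
      countUpTo inLam? h (suc q)   ≤⟨ countUpTo-monoʳ inLam? h (*a<⇒<height qa<I) ⟩
      ladderCount I J              ∎
    where
    open ≤-Reasoning
    q : ℕ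
    q = I / a
    h⁺ : ℕ → ℕ × ℕ
    h⁺ = rung (suc I) J
    h : ℕ → ℕ × ℕ
    h = rung I J
    lifted : ∀ {u} → u < suc q → InLam (h⁺ u) → InLam (h u)
    lifted {u} u≤q = rung-lift {J = J} {u} (≤-<-trans (*-monoˡ-≤ a (s≤s⁻¹ u≤q)) qa<I)
  ... | inj₂ qa≡I = subst (λ I → t < ladderCount (suc I) J → t < ladderCount I J) qa≡I
    (ladderCount-up-top (conditions J₀) (*-cancelʳ-< a t (I / a) (subst (t * a <_) (sym qa≡I) ta<I)))

  Cr-upClosed : RungConditions → UpClosed Cr
  Cr-upClosed conditions i j 1≤i cr⁺ with column-decomposition (proj₁ (proj₂ cr⁺))
  ... | J , t , J₀ , refl = Equivalence.from (Cr⇔ t 1≤i J₀)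
    (ladderCount-up conditions J₀ (+-monoˡ-≤ (t * a) 1≤i) (Equivalence.to (Cr⇔ t (s≤s z≤n) J₀) cr⁺))

  ladderCount-left : ∀ {I J} → 1 ≤ J → ladderCount I (suc J) ≤ ladderCount I J
  ladderCount-left {I} {J} 1≤J = countUpTo-mono inLam? (rung I (suc J)) (rung I J) (height I)
    λ {u} _ → InDiagram-leftClosed {lam} (I ∸ u * a) (J + u * d) (≤-trans 1≤J (m≤m+n J (u * d)))

  -- Left of a ladder with base column 1 lies, one rung lower, the ladder with base column d.
  ladderCount-wrap : ∀ {I} → 1 ≤ I → ladderCount (I + a) 1 ≤ suc (ladderCount I d)
  ladderCount-wrap {I} 1≤I = begin
      countUpTo inLam? h⁺ (height (I + a))          ≡⟨ cong (countUpTo inLam? h⁺) (height-+a 1≤I) ⟩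
      countUpTo inLam? h⁺ (suc (height I))          ≤⟨ countUpTo-suc inLam? h⁺ (height I) ⟩
      suc (countUpTo inLam? (h⁺ ∘ suc) (height I))  ≤⟨ s≤s (countUpTo-mono inLam? (h⁺ ∘ suc) h (height I) shifted) ⟩
      suc (ladderCount I d)                         ∎
    where
    open ≤-Reasoning
    h⁺ : ℕ → ℕ × ℕ
    h⁺ = rung (I + a) 1
    h : ℕ → ℕ × ℕ
    h = rung I d
    shifted : ∀ {u} → u < height I → InLam (h⁺ (suc u)) → InLam (h u)
    shifted {u} _ in⁺ = InDiagram-leftClosed {lam} (I ∸ u * a) (d + u * d) (≤-trans 1≤d (m≤m+n d (u * d)))
      (subst (λ r → InDiagram lam r (suc (d + u * d)))
             (trans (cong (_∸ (a + u * a)) (+-comm I a)) ([m+n]∸[m+o]≡n∸o a I (u * a)))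
             in⁺)

  Cr-leftClosed : LeftClosed Cr
  Cr-leftClosed i j 1≤j cr⁺ with column-decomposition 1≤j | proj₁ cr⁺
  ... | J , t , J₀@(1≤J , J≤d) , refl | 1≤i with m≤n⇒m<n∨m≡n J≤d
  ...   | inj₁ J<d = Equivalence.from (Cr⇔ t 1≤i J₀)
    (<-≤-trans (Equivalence.to (Cr⇔ t 1≤i (s≤s z≤n , J<d)) cr⁺) (ladderCount-left {i + t * a} 1≤J))
  ...   | inj₂ refl = Equivalence.from (Cr⇔ t 1≤i J₀)
    (s<s⁻¹ (<-≤-trans (Equivalence.to (Cr⇔ (suc t) 1≤i (≤-refl , 1≤d)) cr⁺) wrap))
    where
    wrap : ladderCount (i + suc t * a) 1 ≤ suc (ladderCount (i + t * a) d)
    wrap = subst (λ I → ladderCount I 1 ≤ suc (ladderCount (i + t * a) d))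
             (trans (+-assoc i (t * a) a) (cong (λ x → i + x) (+-comm (t * a) a)))
             (ladderCount-wrap (≤-trans 1≤i (m≤m+n i (t * a))))

  rung-index-bound : ∀ {I J u} → InLam (rung I J u) → u ≤ part lam 1
  rung-index-bound {I} {J} {u} (1≤row , _ , col≤) = begin
      u                  ≤⟨ m≤m*n u d ⟩
      u * d              ≤⟨ m≤n+m (u * d) J ⟩
      J + u * d          ≤⟨ col≤ ⟩
      part lam (I ∸ u * a) ≤⟨ part≤part₁ lam↓ 1≤row ⟩
      part lam 1         ∎
    where open ≤-Reasoning

  Cr-bounded : ∀ {i j} → Cr i j → i ≤ part lam 1 * a + length lam × j ≤ d + part lam 1 * d
  Cr-bounded {i} cr with column-decomposition (proj₁ (proj₂ cr))
  ... | J , t , J₀ , refl = i≤ , +-mono-≤ (proj₂ J₀) (*-monoˡ-≤ d t≤λ₁)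
    where
    I : ℕ
    I = i + t * a
    t<c : t < ladderCount I J
    t<c = Equivalence.to (Cr⇔ t (proj₁ cr) J₀) cr

    t≤λ₁ : t ≤ part lam 1
    t≤λ₁ = s≤s⁻¹ (<-≤-trans t<c
      (countUpTo-bounded inLam? (rung I J) (height I) (suc (part lam 1)) λ _ inλ → s≤s (rung-index-bound inλ)))

    i≤ : i ≤ part lam 1 * a + length lam
    i≤ with countUpTo-pos⇒∃ inLam? (rung I J) (height I) (≤-<-trans z≤n t<c)
    ... | u , _ , inλ@(_ , 1≤col , col≤) = begin
        i                       ≤⟨ m≤m+n i (t * a) ⟩
        I                       ≤⟨ m≤n+m∸n I (u * a) ⟩
        u * a + (I ∸ u * a)     ≤⟨ +-mono-≤ (*-monoˡ-≤ a (rung-index-bound {I} {J} {u} inλ))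
                                            (part-length lam (I ∸ u * a) (≤-trans 1≤col col≤)) ⟩
        part lam 1 * a + length lam ∎
      where open ≤-Reasoning

  Cr? : ∀ i j → Dec (Cr i j)
  Cr? i j = (1 ≤? i) ×-dec ((1 ≤? j) ×-dec ((i , j) ∈? _))

  IsPartitionSet⇔upClosed : IsPartitionSet Cr ⇔ UpClosed Cr
  IsPartitionSet⇔upClosed = mk⇔ IsPartitionSet⇒upClosed λ up →
    closed⇒IsPartitionSet Cr? (λ cr → proj₁ cr , proj₁ (proj₂ cr)) up Cr-leftClosed _ _ Cr-bounded

  upClosed⇒rungConditions : UpClosed Cr → RungConditions
  upClosed⇒rungConditions up {J} {s} J₀ top with suc s ≤? countUpTo inLam? (rung (suc (s * a)) J) (suc s)
  ... | yes full = inj₁ λ u≤s → countUpTo-all⁻ inLam? (rung (suc (s * a)) J) (suc s) full (s≤s u≤s)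
  ... | no ¬full = inj₂ (countUpTo-<⇒∃ inLam? h⁺ h s c<count)
    where
    h⁺ : ℕ → ℕ × ℕ
    h⁺ = rung (suc (s * a)) J
    h : ℕ → ℕ × ℕ
    h = rung (s * a) J
    c : ℕ
    c = countUpTo inLam? h⁺ s

    c⁺≡ : ladderCount (suc (s * a)) J ≡ suc c
    c⁺≡ = trans (cong (countUpTo inLam? h⁺) (height-suc-*a s)) (countUpTo-accept inLam? h⁺ s top)

    c<s : c < s
    c<s = s<s⁻¹ (subst (_< suc s) (countUpTo-accept inLam? h⁺ s top) (≰⇒> ¬full))

    i : ℕ
    i = (s ∸ c) * a

    i+ca≡sa : i + c * a ≡ s * a
    i+ca≡sa = trans (cong (_+ c * a) (*-distribʳ-∸ a s c)) (m∸n+n≡m (*-monoˡ-≤ a (<⇒≤ c<s)))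

    1≤i : 1 ≤ i
    1≤i = ≤-trans (m<n⇒0<n∸m c<s) (m≤m*n (s ∸ c) a)

    cr⁺ : Cr (suc i) (J + c * d)
    cr⁺ = Equivalence.from (Cr⇔ c (s≤s z≤n) J₀)
      (subst (λ I → c < ladderCount (suc I) J) (sym i+ca≡sa) (subst (c <_) (sym c⁺≡) (n<1+n c)))

    c<count : c < countUpTo inLam? h s
    c<count = subst (λ n → c < countUpTo inLam? h n) (height-*a (≤-<-trans z≤n c<s))
      (subst (λ I → c < ladderCount I J) i+ca≡sa (Equivalence.to (Cr⇔ c 1≤i J₀) (up i _ 1≤i cr⁺)))

  -- The ladders ℓ_{x,y} of the statement

  private
    x+k*a≡x-[-k]*a : ∀ (x k a : ℤ) → x ℤ.+ k ℤ.* a ≡ x ℤ.- (ℤ.- k) ℤ.* a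
    x+k*a≡x-[-k]*a = solve-∀

    j≡[j+k*d]+[-k]*d : ∀ (j k d : ℤ) → j ≡ (j ℤ.+ k ℤ.* d) ℤ.+ (ℤ.- k) ℤ.* d
    j≡[j+k*d]+[-k]*d = solve-∀

    [y+[-k]*d]+k*d≡y : ∀ (y k d : ℤ) → (y ℤ.+ (ℤ.- k) ℤ.* d) ℤ.+ k ℤ.* d ≡ y
    [y+[-k]*d]+k*d≡y = solve-∀

    [x-k*a]+k*a≡x : ∀ (x k a : ℤ) → (x ℤ.- k ℤ.* a) ℤ.+ k ℤ.* a ≡ x
    [x-k*a]+k*a≡x = solve-∀

    +b-+a≡+d : + b ℤ.- + a ≡ + d
    +b-+a≡+d = trans (m-n≡m⊖n b a) (⊖-≥ (<⇒≤ a<b))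

    +[m+n*o] : ∀ m n o → + (m + n * o) ≡ + m ℤ.+ + n ℤ.* + o
    +[m+n*o] m n o = trans (pos-+ m (n * o)) (cong (λ e → + m ℤ.+ e) (pos-* n o))

    InLadder⇒-descending : ∀ {x y i j} k →
                           + i ≡ + x ℤ.- (ℤ.- + k) ℤ.* + a → + j ≡ + y ℤ.+ (ℤ.- + k) ℤ.* (+ b ℤ.- + a) →
                           ∃[ k ] (i ≡ x + k * a × j + k * d ≡ y)
    InLadder⇒-descending {x} {y} {i} {j} k eᵢ eⱼ = k ,
      +-injective (trans eᵢ (trans (sym (x+k*a≡x-[-k]*a (+ x) (+ k) (+ a))) (sym (+[m+n*o] x k a)))) ,
      +-injective (begin
        + (j + k * d)                                        ≡⟨ +[m+n*o] j k d ⟩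
        + j ℤ.+ + k ℤ.* + d                                  ≡⟨ cong (λ e → e ℤ.+ + k ℤ.* + d) eⱼ ⟩
        (+ y ℤ.+ (ℤ.- + k) ℤ.* (+ b ℤ.- + a)) ℤ.+ + k ℤ.* + d ≡⟨ cong (λ e → (+ y ℤ.+ (ℤ.- + k) ℤ.* e) ℤ.+ + k ℤ.* + d)
                                                                  +b-+a≡+d ⟩
        (+ y ℤ.+ (ℤ.- + k) ℤ.* + d) ℤ.+ + k ℤ.* + d          ≡⟨ [y+[-k]*d]+k*d≡y (+ y) (+ k) (+ d) ⟩
        + y                                                  ∎)
      where open ≡-Reasoning

  ⇒InLadder : ∀ {x k j} → 1 ≤ x + k * a → 1 ≤ j → InLadder a b (+ x) (+ (j + k * d)) (x + k * a) j
  ⇒InLadder {x} {k} {j} 1≤i 1≤j = 1≤i , 1≤j , ℤ.- + k ,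
    trans (+[m+n*o] x k a) (x+k*a≡x-[-k]*a (+ x) (+ k) (+ a)) ,
    (begin
      + j                                               ≡⟨ j≡[j+k*d]+[-k]*d (+ j) (+ k) (+ d) ⟩
      (+ j ℤ.+ + k ℤ.* + d) ℤ.+ (ℤ.- + k) ℤ.* + d       ≡⟨ cong₂ (λ y e → y ℤ.+ (ℤ.- + k) ℤ.* e)
                                                             (sym (+[m+n*o] j k d)) (sym +b-+a≡+d) ⟩
      + (j + k * d) ℤ.+ (ℤ.- + k) ℤ.* (+ b ℤ.- + a)     ∎)
    where open ≡-Reasoning

  InLadder⇒ : ∀ {x y i j} → x ≤ 1 → InLadder a b (+ x) (+ y) i j → ∃[ k ] (i ≡ x + k * a × j + k * d ≡ y)
  InLadder⇒ _ (_ , _ , + zero   , eᵢ , eⱼ) = InLadder⇒-descending 0 eᵢ eⱼ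
  InLadder⇒ _ (_ , _ , -[1+ k ] , eᵢ , eⱼ) = InLadder⇒-descending (suc k) eᵢ eⱼ
  InLadder⇒ {x} {i = i} x≤1 (1≤i , _ , + suc k , eᵢ , _) =
    contradiction (≤-trans (+-mono-≤ 1≤i (≤-trans (s≤s z≤n) (m≤m*n (suc k) a))) (≤-reflexive i+ka≡x))
                  (<⇒≱ (s≤s x≤1))
    where
    open ≡-Reasoning
    i+ka≡x : i + suc k * a ≡ x
    i+ka≡x = +-injective (begin
      + (i + suc k * a)                             ≡⟨ +[m+n*o] i (suc k) a ⟩
      + i ℤ.+ + suc k ℤ.* + a                       ≡⟨ cong (λ e → e ℤ.+ + suc k ℤ.* + a) eᵢ ⟩
      (+ x ℤ.- + suc k ℤ.* + a) ℤ.+ + suc k ℤ.* + a ≡⟨ [x-k*a]+k*a≡x (+ x) (+ suc k) (+ a) ⟩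
      + x                                           ∎)

  rung-row : ∀ x {s u} → u ≤ s → x + s * a ∸ u * a ≡ x + (s ∸ u) * a
  rung-row x {s} {u} u≤s =
    trans (+-∸-assoc x (*-monoˡ-≤ a u≤s)) (cong (λ m → x + m) (sym (*-distribʳ-∸ a s u)))

  rung-column : ∀ J {s u} → u ≤ s → J + u * d + (s ∸ u) * d ≡ J + s * d
  rung-column J {s} {u} u≤s =
    trans (+-assoc J (u * d) _)
          (cong (λ m → J + m) (trans (sym (*-distribʳ-+ d u (s ∸ u))) (cong (_* d) (m+[n∸m]≡n u≤s))))

  rung⇒InLadder : ∀ x {J s u} → BaseColumn J → u ≤ s → 1 ≤ x + (s ∸ u) * a →
                  InLadder a b (+ x) (+ (J + s * d)) (x + s * a ∸ u * a) (J + u * d)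
  rung⇒InLadder x {J} {s} {u} J₀ u≤s 1≤row =
    subst₂ (λ y r → InLadder a b (+ x) (+ y) r (J + u * d)) (rung-column J u≤s) (sym (rung-row x u≤s))
      (⇒InLadder {k = s ∸ u} 1≤row (≤-trans (proj₁ J₀) (m≤m+n J (u * d))))

  InLadder⇒rung : ∀ {x J s i j} → x ≤ 1 → BaseColumn J → InLadder a b (+ x) (+ (J + s * d)) i j →
                  ∃[ u ] (u ≤ s × rung (x + s * a) J u ≡ (i , j))
  InLadder⇒rung {x} {J} {s} {i} {j} x≤1 (_ , J≤d) ladder with InLadder⇒ x≤1 ladder
  ... | k , refl , j+kd≡y = s ∸ k , m∸n≤m s k , cong₂ _,_ row column
    where
    open ≤-Reasoning
    k≤s : k ≤ s
    k≤s = ≮⇒≥ λ s<k → <⇒≢ (begin-strict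
      J + s * d   ≤⟨ +-monoˡ-≤ (s * d) J≤d ⟩
      suc s * d   ≤⟨ *-monoˡ-≤ d s<k ⟩
      k * d       <⟨ m<n+m (k * d) (proj₁ (proj₂ ladder)) ⟩
      j + k * d   ∎) (sym j+kd≡y)

    row : x + s * a ∸ (s ∸ k) * a ≡ x + k * a
    row = trans (rung-row x (m∸n≤m s k)) (cong (λ m → x + m * a) (m∸[m∸n]≡n k≤s))

    column : J + (s ∸ k) * d ≡ j
    column = +-cancelʳ-≡ (k * d) (J + (s ∸ k) * d) j (trans
      (cong (λ m → J + (s ∸ k) * d + m * d) (sym (m∸[m∸n]≡n k≤s)))
      (trans (rung-column J (m∸n≤m s k)) (sym j+kd≡y)))

  LadderCondition : Set
  LadderCondition = ∀ y → 1 ≤ y → y ≤ part lam 1 →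
    (∀ i j → InLadder a b (+ 1) (+ y) i j → InDiagram lam i j)
    ⊎ (∃[ i ] ∃[ j ] (InDiagram lam i j × InLadder a b (+ 0) (+ y) i j × ¬ InDiagram lam (suc i) j))

  top-row : ∀ J s → proj₁ (rung (suc (s * a)) J s) ≡ 1
  top-row J s = m+n∸n≡m 1 (s * a)

  ladderCondition⇒rungConditions : LadderCondition → RungConditions
  ladderCondition⇒rungConditions condition {J} {s} J₀ top
    with subst (λ r → InDiagram lam r (J + s * d)) (top-row J s) top
  ... | _ , 1≤y , y≤λ₁ with condition (J + s * d) 1≤y y≤λ₁
  ...   | inj₁ all = inj₁ λ u≤s → all _ _ (rung⇒InLadder 1 J₀ u≤s (s≤s z≤n))
  ...   | inj₂ (i , j , inλ , ladder , out) with InLadder⇒rung {s = s} z≤n J₀ ladder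
  ...     | u , u≤s , refl = inj₂ (u , u<s , inλ ,
    out ∘ subst (λ r → InDiagram lam r (J + u * d)) (rung-suc J u (*-monoˡ-≤ a u≤s)))
    where
    u<s : u < s
    u<s = ≤∧≢⇒< u≤s λ { refl → contradiction (subst (1 ≤_) (n∸n≡0 (s * a)) (proj₁ inλ)) λ () }

  rungConditions⇒ladderCondition : RungConditions → LadderCondition
  rungConditions⇒ladderCondition conditions y 1≤y y≤λ₁ with column-decomposition 1≤y
  ... | J , s , J₀ , refl
    with conditions J₀ (subst (λ r → InDiagram lam r (J + s * d)) (sym (top-row J s)) (s≤s z≤n , 1≤y , y≤λ₁))
  ...   | inj₁ all = inj₁ onLadder
    where
    onLadder : ∀ i j → InLadder a b (+ 1) (+ (J + s * d)) i j → InDiagram lam i j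
    onLadder i j ladder with InLadder⇒rung {s = s} (s≤s z≤n) J₀ ladder
    ... | u , u≤s , refl = all u≤s
  ...   | inj₂ (u , u<s , inλ , out) = inj₂ (s * a ∸ u * a , J + u * d , inλ ,
    rung⇒InLadder 0 J₀ (<⇒≤ u<s) (≤-trans (m<n⇒0<n∸m u<s) (m≤m*n (s ∸ u) a)) ,
    out ∘ subst (λ r → InDiagram lam r (J + u * d)) (sym (rung-suc J u (*-monoˡ-≤ a (<⇒≤ u<s)))))

  upClosed⇔rungConditions : UpClosed Cr ⇔ RungConditions
  upClosed⇔rungConditions = mk⇔ upClosed⇒rungConditions Cr-upClosed

  rungConditions⇔ladderCondition : RungConditions ⇔ LadderCondition
  rungConditions⇔ladderCondition = mk⇔ rungConditions⇒ladderCondition ladderCondition⇒rungConditions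

lemma2p16 : (a b : ℕ) (0<a : 0 < a) (a<b : a < b) (lam : List ℕ) → IsPartition lam →
    (IsPartitionSet (InCr a b 0<a a<b lam)
      ⇔ (∀ y → 1 ≤ y → y ≤ part lam 1 →
           (∀ i j → InLadder a b (+ 1) (+ y) i j → InDiagram lam i j)
           ⊎ (∃[ i ] ∃[ j ] (InDiagram lam i j × InLadder a b (+ 0) (+ y) i j
                             × ¬ InDiagram lam (suc i) j))))
lemma2p16 a b 0<a a<b lam lam↓ =
  rungConditions⇔ladderCondition ⇔-∘ (upClosed⇔rungConditions ⇔-∘ IsPartitionSet⇔upClosed)
  where open SlideDown a b 0<a a<b lam lam↓
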